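{- Let $k$ be a positive integer and let $A$ be a nonempty vertex set in a finite multigraph $G$. Then there is a set $X\subseteq E(G)$ of size at most $(|A|-1)(k-1)$ that $k$-perfectly separates $A$.
   Context: For vertices $u,v$ of a multigraph $H$, $u\sim_k v$ in $H$ holds if either $u=v$ or there are $k$ edge-disjoint $u$--$v$-paths in $H$. $G-X$ denotes $G$ with the edges of $X$ deleted. An edge set $X$ $k$-perfectly separates $A$ if for all $a,a'\in A$ such that $a\not\sim_k a'$ in $G-X$, the vertices $a$ and $a'$ lie in different components of $G-X$. -}

module Defs where

open import Data.Nat using (ℕ)
open import Data.Fin using (Fin)
open import Data.Fin.Subset using (Subset; _∈_; _∉_)
open import Data.List using (List; []; _∷_)
open import Data.List.Relation.Unary.Unique.Propositional using (Unique)
import Data.List.Membership.Propositional as LM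
open import Data.Product using (_×_; _,_; Σ; ∃; ∃-syntax)
open import Data.Sum using (_⊎_)
open import Relation.Binary.PropositionalEquality using (_≡_)
open import Relation.Nullary using (¬_)

-- A finite multigraph: vertices Fin n, edges Fin m, each edge has an
-- (unordered) pair of endpoints; parallel edges and loops allowed.
record Multigraph : Set where
  field
    n    : ℕ
    m    : ℕ
    ends : Fin m → Fin n × Fin n

open Multigraph public

Vertex : Multigraph → Set
Vertex G = Fin (n G)

EdgeSet : Multigraph → Set
EdgeSet G = Subset (m G)

Joins : (G : Multigraph) → Fin (m G) → Vertex G → Vertex G → Set
Joins G e u w = ends G e ≡ (u , w) ⊎ ends G e ≡ (w , u)

data Walk (G : Multigraph) (X : EdgeSet G) :
     Vertex G → Vertex G → List (Fin (m G)) → List (Vertex G) → Set where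
  here : ∀ {u} → Walk G X u u [] (u ∷ [])
  step : ∀ {u w v e es vs} → e ∉ X → Joins G e u w →
         Walk G X w v es vs → Walk G X u v (e ∷ es) (u ∷ vs)

IsPath : (G : Multigraph) (X : EdgeSet G) → Vertex G → Vertex G →
         List (Fin (m G)) → Set
IsPath G X u v es = ∃[ vs ] (Walk G X u v es vs × Unique vs)

EdgeDisjointPaths : (G : Multigraph) (X : EdgeSet G) → ℕ →
                    Vertex G → Vertex G → Set
EdgeDisjointPaths G X k u v =
  Σ (Fin k → List (Fin (m G))) λ P →
    (∀ i → IsPath G X u v (P i)) ×
    (∀ i j e → e LM.∈ P i → e LM.∈ P j → i ≡ j)

Sim : (G : Multigraph) (X : EdgeSet G) → ℕ → Vertex G → Vertex G → Set
Sim G X k u v = u ≡ v ⊎ EdgeDisjointPaths G X k u v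

SameComponent : (G : Multigraph) (X : EdgeSet G) → Vertex G → Vertex G → Set
SameComponent G X u v = ∃[ es ] ∃[ vs ] Walk G X u v es vs

PerfectlySeparates : (G : Multigraph) → ℕ → EdgeSet G → Subset (n G) → Set
PerfectlySeparates G k X A =
  ∀ a a' → a ∈ A → a' ∈ A → ¬ Sim G X k a a' → ¬ SameComponent G X a a'

-- Keep a set R ⊆ A of vertices in pairwise different components of G − X, with
-- |X| ≤ (|R| − 1)(k − 1), starting from one vertex of A and X = ∅. If X does not yet
-- k-perfectly separate A, some a, a′ ∈ A share a component of G − X but are not joined by
-- k edge-disjoint paths, so by the edge version of Menger's theorem in G − X some C with
-- |C| ≤ k − 1 separates a from a′ in G − X − C. At most one r ∈ R lies in the component of a.
-- If there is none, a joins R. Otherwise C separates r from a or from a′; that vertex joins R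
-- and C is added to X. Since R grows inside A, the process stops.
--
-- Menger's theorem comes from Ford–Fulkerson with unit capacities: augment an integral
-- s–t flow along residual trails. When t is not residually reachable from s, the flow edges
-- leaving the reachable set form a cut whose size is the value of the flow, and a flow of
-- value k splits into k edge-disjoint s–t paths, found by walking back from t along flow edges.

module Submission where

open import Defs
open import Algebra.Properties.Semiring.Sum as Sum using ()
open import Data.Bool using (Bool; true; false; _∧_; not)
open import Data.Empty using (⊥-elim)
open import Data.Fin using (Fin; zero; suc)
open import Data.Fin.Properties as FinP using (any?; ¬∀⟶∃¬)
open import Data.Fin.Subset using (Subset; _∈_; _∉_; _⊆_; _⊂_; _∪_; ∣_∣; ⁅_⁆; ⊤; ⊥; ∁)
open import Data.Fin.Subset.Properties as SubsetP using (_∈?_)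
open import Data.List using (List; []; _∷_)
open import Data.List.Membership.Propositional using () renaming (_∈_ to _∈ₗ_)
open import Data.List.Relation.Unary.All as All using (All; []; _∷_)
open import Data.List.Relation.Unary.All.Properties using (¬Any⇒All¬; All¬⇒¬Any)
open import Data.List.Relation.Unary.Any using (here; there)
open import Data.List.Relation.Unary.AllPairs using ([]; _∷_)
open import Data.List.Relation.Unary.Unique.Propositional using (Unique)
open import Data.Integer as ℤ using (ℤ; 0ℤ; 1ℤ)
open import Data.Integer.Properties as ℤP using ()
open import Data.Integer.Tactic.RingSolver using (solve-∀)
open import Data.Nat as ℕ using (ℕ; zero; suc; _≤_; _<_; _∸_)
open import Data.Nat.Properties as ℕP using ()
open import Data.Product.Properties using (≡-dec)
open import Data.Product using (Σ; ∃; ∃₂; ∃-syntax; _×_; _,_; proj₁; proj₂; map₂)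
open import Data.Sum using (_⊎_; inj₁; inj₂)
open import Data.Vec using ([]; _∷_; lookup; tabulate)
open import Data.Vec.Functional using (updateAt)
open import Data.Vec.Functional.Properties using (updateAt-updates; updateAt-minimal)
open import Data.Vec.Properties using (lookup∘tabulate; lookup⇒[]=; []=⇒lookup)
open import Function using (_∘_)
open import Relation.Binary.PropositionalEquality
open import Relation.Nullary using (¬_; ¬?; Dec; yes; no; does; _×-dec_; _⊎-dec_)
open import Relation.Nullary.Decidable using (dec-true; dec-false)

module IntegerSums where

  open import Data.Integer using (+_; _+_; _-_; _*_)
  open Sum ℤP.+-*-semiring using (sum; sum-syntax; sum-cong-≗; ∑-comm; *-distribˡ-sum; sum-replicate-zero) public

  ⟦_⟧ : Bool → ℤ
  ⟦ true ⟧ = 1ℤ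
  ⟦ false ⟧ = 0ℤ

  δ : ∀ {n} → Fin n → Fin n → ℤ
  δ a v = ⟦ does (a FinP.≟ v) ⟧

  χ : ∀ {n} → Subset n → Fin n → ℤ
  χ p i = ⟦ lookup p i ⟧

  ∑-update : ∀ {n} (f g : Fin n → ℤ) (e : Fin n) → (∀ i → i ≢ e → g i ≡ f i) →
             sum g ≡ sum f - f e + g e
  ∑-update {suc n} f g zero same = begin
    g zero + sum (g ∘ suc)                   ≡⟨ cong (λ s → g zero + s) (sum-cong-≗ (λ i → same (suc i) λ ())) ⟩
    g zero + sum (f ∘ suc)                   ≡⟨ swap (g zero) (f zero) (sum (f ∘ suc)) ⟩
    f zero + sum (f ∘ suc) - f zero + g zero ∎
    where
    open ≡-Reasoning
    swap : ∀ a b s → a + s ≡ b + s - b + a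
    swap = solve-∀
  ∑-update {suc n} f g (suc e) same = begin
    g zero + sum (g ∘ suc)                           ≡⟨ cong₂ _+_ (same zero λ ()) (∑-update (f ∘ suc) (g ∘ suc) e same′) ⟩
    f zero + (sum (f ∘ suc) - f (suc e) + g (suc e)) ≡⟨ reassoc (f zero) (sum (f ∘ suc)) (f (suc e)) (g (suc e)) ⟩
    f zero + sum (f ∘ suc) - f (suc e) + g (suc e)   ∎
    where
    open ≡-Reasoning
    same′ : ∀ i → i ≢ e → g (suc i) ≡ f (suc i)
    same′ i i≢e = same (suc i) (i≢e ∘ FinP.suc-injective)
    reassoc : ∀ a s b c → a + (s - b + c) ≡ a + s - b + c
    reassoc = solve-∀

  +-sub-cancel : ∀ x y → x + y - y ≡ x
  +-sub-cancel = solve-∀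

  ∑-single : ∀ {n} (f : Fin n → ℤ) (e : Fin n) → (∀ i → i ≢ e → f i ≡ 0ℤ) → sum f ≡ f e
  ∑-single {n} f e vanishes = begin
    sum f                          ≡⟨ ∑-update (λ _ → 0ℤ) f e vanishes ⟩
    sum {n} (λ _ → 0ℤ) - 0ℤ + f e  ≡⟨ cong (λ s → s - 0ℤ + f e) (sum-replicate-zero n) ⟩
    0ℤ - 0ℤ + f e                  ≡⟨ ℤP.+-identityˡ (f e) ⟩
    f e                            ∎
    where open ≡-Reasoning

  ∑-sub : ∀ {n} (f g : Fin n → ℤ) → sum (λ i → f i - g i) ≡ sum f - sum g
  ∑-sub {zero} f g = refl
  ∑-sub {suc n} f g = begin
    f zero - g zero + sum (λ i → f (suc i) - g (suc i)) ≡⟨ cong (λ s → f zero - g zero + s) (∑-sub (f ∘ suc) (g ∘ suc)) ⟩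
    f zero - g zero + (sum (f ∘ suc) - sum (g ∘ suc))   ≡⟨ regroup (f zero) (g zero) (sum (f ∘ suc)) (sum (g ∘ suc)) ⟩
    f zero + sum (f ∘ suc) - (g zero + sum (g ∘ suc))   ∎
    where
    open ≡-Reasoning
    regroup : ∀ a b s t → a - b + (s - t) ≡ a + s - (b + t)
    regroup = solve-∀

  δ-refl : ∀ {n} (a : Fin n) → δ a a ≡ 1ℤ
  δ-refl a = cong ⟦_⟧ (dec-true (a FinP.≟ a) refl)

  δ-≢ : ∀ {n} {a v : Fin n} → a ≢ v → δ a v ≡ 0ℤ
  δ-≢ {a = a} {v} a≢v = cong ⟦_⟧ (dec-false (a FinP.≟ v) a≢v)

  ∑-*-δ : ∀ {n} (h : Fin n → ℤ) (a : Fin n) → sum (λ v → h v * δ a v) ≡ h a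
  ∑-*-δ h a = begin
    sum (λ v → h v * δ a v) ≡⟨ ∑-single (λ v → h v * δ a v) a off-a ⟩
    h a * δ a a             ≡⟨ cong (h a *_) (δ-refl a) ⟩
    h a * 1ℤ                ≡⟨ ℤP.*-identityʳ (h a) ⟩
    h a                     ∎
    where
    open ≡-Reasoning
    off-a : ∀ v → v ≢ a → h v * δ a v ≡ 0ℤ
    off-a v v≢a = trans (cong (h v *_) (δ-≢ (v≢a ∘ sym))) (ℤP.*-zeroʳ (h v))

  ∑-*-δ-δ : ∀ {n} (h : Fin n → ℤ) (a b : Fin n) → sum (λ v → h v * (δ a v - δ b v)) ≡ h a - h b
  ∑-*-δ-δ h a b = begin
    sum (λ v → h v * (δ a v - δ b v))               ≡⟨ sum-cong-≗ (λ v → *-distrib-sub (h v) (δ a v) (δ b v)) ⟩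
    sum (λ v → h v * δ a v - h v * δ b v)           ≡⟨ ∑-sub (λ v → h v * δ a v) (λ v → h v * δ b v) ⟩
    sum (λ v → h v * δ a v) - sum (λ v → h v * δ b v) ≡⟨ cong₂ _-_ (∑-*-δ h a) (∑-*-δ h b) ⟩
    h a - h b                                       ∎
    where
    open ≡-Reasoning
    *-distrib-sub : ∀ x y z → x * (y - z) ≡ x * y - x * z
    *-distrib-sub = solve-∀

  ∑-nonneg : ∀ {n} (f : Fin n → ℤ) → (∀ i → 0ℤ ℤ.≤ f i) → 0ℤ ℤ.≤ sum f
  ∑-nonneg {zero} f _ = ℤP.≤-refl
  ∑-nonneg {suc n} f nonneg = ℤP.+-mono-≤ (nonneg zero) (∑-nonneg (f ∘ suc) (nonneg ∘ suc))

  ∑-negative : ∀ {n} (f : Fin n → ℤ) → sum f ℤ.< 0ℤ → ∃ λ i → f i ℤ.< 0ℤ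
  ∑-negative {n} f negative =
    map₂ ℤP.≰⇒> (¬∀⟶∃¬ n _ (λ i → 0ℤ ℤ.≤? f i) (λ nonneg → ℤP.<⇒≱ negative (∑-nonneg f nonneg)))

  δ-nonneg : ∀ {n} (a v : Fin n) → 0ℤ ℤ.≤ δ a v
  δ-nonneg a v with does (a FinP.≟ v)
  ... | true = ℤ.+≤+ ℕ.z≤n
  ... | false = ℤ.+≤+ ℕ.z≤n
  ∑-χ : ∀ {n} (p : Subset n) → sum (χ p) ≡ + ∣ p ∣
  ∑-χ [] = refl
  ∑-χ (true ∷ p) = cong (λ s → 1ℤ + s) (∑-χ p)
  ∑-χ (false ∷ p) = trans (ℤP.+-identityˡ (sum (χ p))) (∑-χ p)

  ⟦⟧-monus : ∀ x y → (y ≡ true → x ≡ true) → ⟦ x ⟧ - ⟦ y ⟧ ≡ ⟦ x ∧ not y ⟧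
  ⟦⟧-monus true true _ = refl
  ⟦⟧-monus true false _ = refl
  ⟦⟧-monus false false _ = refl
  ⟦⟧-monus false true y⇒x with () ← y⇒x refl

∈-tabulate⁺ : ∀ {n} (g : Fin n → Bool) {i} → g i ≡ true → i ∈ tabulate g
∈-tabulate⁺ g {i} gi = lookup⇒[]= i (tabulate g) (trans (lookup∘tabulate g i) gi)

∈-tabulate⁻ : ∀ {n} (g : Fin n → Bool) {i} → i ∈ tabulate g → g i ≡ true
∈-tabulate⁻ g {i} i∈ = trans (sym (lookup∘tabulate g i)) ([]=⇒lookup i∈)

∣p∪q∣≤∣p∣+∣q∣ : ∀ {n} (p q : Subset n) → ∣ p ∪ q ∣ ≤ ∣ p ∣ ℕ.+ ∣ q ∣
∣p∪q∣≤∣p∣+∣q∣ [] [] = ℕ.z≤n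
∣p∪q∣≤∣p∣+∣q∣ (true ∷ p) (true ∷ q) =
  ℕ.s≤s (ℕP.≤-trans (∣p∪q∣≤∣p∣+∣q∣ p q) (ℕP.+-monoʳ-≤ ∣ p ∣ (ℕP.n≤1+n ∣ q ∣)))
∣p∪q∣≤∣p∣+∣q∣ (true ∷ p) (false ∷ q) = ℕ.s≤s (∣p∪q∣≤∣p∣+∣q∣ p q)
∣p∪q∣≤∣p∣+∣q∣ (false ∷ p) (true ∷ q) =
  ℕP.≤-trans (ℕ.s≤s (∣p∪q∣≤∣p∣+∣q∣ p q)) (ℕP.≤-reflexive (sym (ℕP.+-suc ∣ p ∣ ∣ q ∣)))
∣p∪q∣≤∣p∣+∣q∣ (false ∷ p) (false ∷ q) = ∣p∪q∣≤∣p∣+∣q∣ p q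

p⊂⁅x⁆∪p : ∀ {n} {x : Fin n} {p : Subset n} → x ∉ p → p ⊂ ⁅ x ⁆ ∪ p
p⊂⁅x⁆∪p {x = x} {p} x∉p = SubsetP.q⊆p∪q ⁅ x ⁆ p , x , SubsetP.x∈p∪q⁺ (inj₁ (SubsetP.x∈⁅x⁆ x)) , x∉p

∈⁅x⁆∪p⁻ : ∀ {n} {x y : Fin n} {p : Subset n} → y ∈ ⁅ x ⁆ ∪ p → y ≡ x ⊎ y ∈ p
∈⁅x⁆∪p⁻ {x = x} {p = p} y∈ with SubsetP.x∈p∪q⁻ ⁅ x ⁆ p y∈
... | inj₁ y∈⁅x⁆ = inj₁ (SubsetP.x∈⁅y⁆⇒x≡y x y∈⁅x⁆)
... | inj₂ y∈p = inj₂ y∈p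

∀⊎∃ : ∀ {n} {P Q : Fin n → Set} → (∀ i → P i ⊎ Q i) → (∀ i → P i) ⊎ ∃ Q
∀⊎∃ {zero} _ = inj₁ λ ()
∀⊎∃ {suc n} dichotomy with dichotomy zero | ∀⊎∃ (dichotomy ∘ suc)
... | inj₂ q | _ = inj₂ (zero , q)
... | inj₁ _ | inj₂ (i , q) = inj₂ (suc i , q)
... | inj₁ p | inj₁ ps = inj₁ λ { zero → p ; (suc i) → ps i }

⊂-growth-terminates : ∀ {n} {B : Subset n} {Q : Set} (P : Subset n → Set) →
                      (∀ {T} → P T → T ⊆ B) →
                      (∀ {T} → P T → Q ⊎ ∃ λ T′ → T ⊂ T′ × P T′) →
                      ∀ {T} → P T → Q
⊂-growth-terminates {B = B} {Q} P bounded grow {T} = go ∣ B ∣ (ℕP.m≤n+m ∣ B ∣ ∣ T ∣)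
  where
  open ℕP.≤-Reasoning
  go : ∀ slack {T} → ∣ B ∣ ≤ ∣ T ∣ ℕ.+ slack → P T → Q
  go slack room pT with grow pT
  ... | inj₁ q = q
  go zero {T} room pT | inj₂ (T′ , T⊂T′ , pT′) = ⊥-elim (ℕP.<-irrefl refl (begin-strict
    ∣ T ∣        <⟨ SubsetP.p⊂q⇒∣p∣<∣q∣ T⊂T′ ⟩
    ∣ T′ ∣       ≤⟨ SubsetP.p⊆q⇒∣p∣≤∣q∣ (bounded pT′) ⟩
    ∣ B ∣        ≤⟨ room ⟩
    ∣ T ∣ ℕ.+ 0  ≡⟨ ℕP.+-identityʳ ∣ T ∣ ⟩
    ∣ T ∣        ∎))
  go (suc slack) {T} room pT | inj₂ (T′ , T⊂T′ , pT′) = go slack (begin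
    ∣ B ∣                ≤⟨ room ⟩
    ∣ T ∣ ℕ.+ suc slack  ≡⟨ ℕP.+-suc ∣ T ∣ slack ⟩
    suc ∣ T ∣ ℕ.+ slack  ≤⟨ ℕP.+-monoˡ-≤ slack (SubsetP.p⊂q⇒∣p∣<∣q∣ T⊂T′) ⟩
    ∣ T′ ∣ ℕ.+ slack     ∎) pT′

module Trails (G : Multigraph) where

  private
    V = Vertex G
    E = Fin (m G)

  open import Data.List.Membership.DecPropositional (FinP._≟_ {n G}) using () renaming (_∈?_ to _∈ₗ?_)

  StepRel : Set₁
  StepRel = E → V → V → Set

  infixr 5 _◅_

  data Trail (P : StepRel) : V → V → List E → List V → Set where
    ε   : ∀ {u} → Trail P u u [] (u ∷ [])
    _◅_ : ∀ {u w v e es vs} → P e u w → Trail P w v es vs → Trail P u v (e ∷ es) (u ∷ vs)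

  record SimpleTrail (P : StepRel) (u v : V) : Set where
    constructor simpleTrail
    field
      edges    : List E
      vertices : List V
      trail    : Trail P u v edges vertices
      simple   : Unique vertices

  Closed : StepRel → Subset (n G) → Set
  Closed P S = ∀ {e a b} → a ∈ S → P e a b → b ∈ S

  Endpoint : E → V → Set
  Endpoint e x = x ≡ proj₁ (ends G e) ⊎ x ≡ proj₂ (ends G e)

  Joins⇒Endpoint : ∀ {e a b} → Joins G e a b → Endpoint e a
  Joins⇒Endpoint (inj₁ refl) = inj₁ refl
  Joins⇒Endpoint (inj₂ refl) = inj₂ refl

  Endpoint⇒joined : ∀ {e a b x} → Joins G e a b → Endpoint e x → x ≡ a ⊎ x ≡ b
  Endpoint⇒joined (inj₁ refl) (inj₁ refl) = inj₁ refl
  Endpoint⇒joined (inj₁ refl) (inj₂ refl) = inj₂ refl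
  Endpoint⇒joined (inj₂ refl) (inj₁ refl) = inj₂ refl
  Endpoint⇒joined (inj₂ refl) (inj₂ refl) = inj₁ refl

  module _ {P : StepRel} where

    source∈ : ∀ {u v es vs} → Trail P u v es vs → u ∈ₗ vs
    source∈ ε = here refl
    source∈ (_ ◅ _) = here refl

    suffix : ∀ {u v w es vs} → Trail P u v es vs → w ∈ₗ vs →
             ∃₂ λ es′ vs′ → Trail P w v es′ vs′ × (∀ {e} → e ∈ₗ es′ → e ∈ₗ es) × (Unique vs → Unique vs′)
    suffix ε (here refl) = _ , _ , ε , (λ ()) , (λ uniq → uniq)
    suffix (p ◅ W) (here refl) = _ , _ , p ◅ W , (λ e∈ → e∈) , (λ uniq → uniq)
    suffix (p ◅ W) (there w∈) with suffix W w∈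
    ... | es′ , vs′ , W′ , es′⊆es , unique = es′ , vs′ , W′ , there ∘ es′⊆es , λ { (_ ∷ uniq) → unique uniq }

    -- If u already occurs on the trail, the closed walk up to that occurrence is cut off.
    ◅-simple : ∀ {e u w v} → P e u w → (T : SimpleTrail P w v) →
               Σ (SimpleTrail P u v) λ T′ → ∀ {x} → x ∈ₗ SimpleTrail.edges T′ → x ∈ₗ e ∷ SimpleTrail.edges T
    ◅-simple {u = u} p (simpleTrail es vs W uniq) with u ∈ₗ? vs
    ... | yes u∈vs =
      let (es′ , vs′ , W′ , es′⊆es , unique) = suffix W u∈vs
      in simpleTrail es′ vs′ W′ (unique uniq) , there ∘ es′⊆es
    ... | no u∉vs = simpleTrail _ _ (p ◅ W) (¬Any⇒All¬ vs u∉vs ∷ uniq) , λ x∈ → x∈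

    shortcut : ∀ {u v es vs} → Trail P u v es vs → SimpleTrail P u v
    shortcut ε = simpleTrail _ _ ε ([] ∷ [])
    shortcut (p ◅ W) = proj₁ (◅-simple p (shortcut W))

    edges-satisfy : ∀ {Q : E → Set} {u v es vs} → (∀ {e a b} → P e a b → Q e) → Trail P u v es vs →
                    ∀ {e} → e ∈ₗ es → Q e
    edges-satisfy q (p ◅ W) (here refl) = q p
    edges-satisfy q (p ◅ W) (there e∈) = edges-satisfy q W e∈

    Trail-map : ∀ {Q : StepRel} {u v es vs} → (∀ {e a b} → e ∈ₗ es → P e a b → Q e a b) →
                Trail P u v es vs → Trail Q u v es vs
    Trail-map f ε = ε
    Trail-map f (p ◅ W) = f (here refl) p ◅ Trail-map (f ∘ there) W

    module _ (P⇒Joins : ∀ {e a b} → P e a b → Joins G e a b) where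

      endpoint∈vertices : ∀ {u v e x es vs} → Trail P u v es vs → e ∈ₗ es → Endpoint e x → x ∈ₗ vs
      endpoint∈vertices (p ◅ W) (here refl) x-end with Endpoint⇒joined (P⇒Joins p) x-end
      ... | inj₁ refl = here refl
      ... | inj₂ refl = there (source∈ W)
      endpoint∈vertices (p ◅ W) (there e∈) x-end = there (endpoint∈vertices W e∈ x-end)

      unique-edges : ∀ {u v es vs} → Trail P u v es vs → Unique vs → Unique es
      unique-edges ε _ = []
      unique-edges {es = e ∷ es} (p ◅ W) (u∉vs ∷ uniq) =
        ¬Any⇒All¬ es (λ e∈es → All¬⇒¬Any u∉vs (endpoint∈vertices W e∈es (Joins⇒Endpoint (P⇒Joins p))))
          ∷ unique-edges W uniq

    trail-or-closed : (∀ e a b → Dec (P e a b)) → ∀ s t →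
                      (∃₂ λ es vs → Trail P s t es vs) ⊎ (∃ λ S → s ∈ S × t ∉ S × Closed P S)
    trail-or-closed step? s t = ⊂-growth-terminates {B = ⊤} Reaching (λ _ → SubsetP.⊆⊤) grow start
      where
      Result = (∃₂ λ es vs → Trail P s t es vs) ⊎ (∃ λ S → s ∈ S × t ∉ S × Closed P S)

      Reaching : Subset (n G) → Set
      Reaching T = t ∈ T × (∀ {v} → v ∈ T → ∃₂ λ es vs → Trail P v t es vs)

      start : Reaching ⁅ t ⁆
      start = SubsetP.x∈⁅x⁆ t , λ v∈ → case-t (SubsetP.x∈⁅y⁆⇒x≡y t v∈)
        where
        case-t : ∀ {v} → v ≡ t → ∃₂ λ es vs → Trail P v t es vs
        case-t refl = _ , _ , ε

      Entry : Subset (n G) → Set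
      Entry T = ∃ λ e → ∃ λ a → ∃ λ b → a ∉ T × b ∈ T × P e a b

      entry? : ∀ T → Dec (Entry T)
      entry? T = any? λ e → any? λ a → any? λ b → ¬? (a ∈? T) ×-dec (b ∈? T) ×-dec step? e a b

      grow : ∀ {T} → Reaching T → Result ⊎ ∃ λ T′ → T ⊂ T′ × Reaching T′
      grow {T} (t∈T , reach) with entry? T
      ... | yes (e , a , b , a∉T , b∈T , p) = inj₂ (⁅ a ⁆ ∪ T , p⊂⁅x⁆∪p a∉T , SubsetP.q⊆p∪q ⁅ a ⁆ T t∈T , reach′)
        where
        reach′ : ∀ {v} → v ∈ ⁅ a ⁆ ∪ T → ∃₂ λ es vs → Trail P v t es vs
        reach′ v∈ with ∈⁅x⁆∪p⁻ v∈
        ... | inj₁ refl = let (es , vs , W) = reach b∈T in _ , _ , p ◅ W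
        ... | inj₂ v∈T = reach v∈T
      ... | no no-entry with s ∈? T
      ...   | yes s∈T = inj₁ (inj₁ (reach s∈T))
      ...   | no s∉T = inj₁ (inj₂ (∁ T , SubsetP.x∉p⇒x∈∁p s∉T , SubsetP.x∈p⇒x∉∁p t∈T , closed))
        where
        closed : Closed P (∁ T)
        closed {e} {a} {b} a∈ p with b ∈? T
        ... | yes b∈T = ⊥-elim (no-entry (e , a , b , SubsetP.x∈∁p⇒x∉p a∈ , b∈T , p))
        ... | no b∉T = SubsetP.x∉p⇒x∈∁p b∉T

module Connectivity (G : Multigraph) where

  open Trails G

  Usable : EdgeSet G → StepRel
  Usable X e u w = e ∉ X × Joins G e u w

  joins? : ∀ e a b → Dec (Joins G e a b)
  joins? e a b = ≡-dec FinP._≟_ FinP._≟_ (ends G e) (a , b) ⊎-dec ≡-dec FinP._≟_ FinP._≟_ (ends G e) (b , a)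

  Joins-sym : ∀ {e a b} → Joins G e a b → Joins G e b a
  Joins-sym (inj₁ eq) = inj₂ eq
  Joins-sym (inj₂ eq) = inj₁ eq

  trail⇒walk : ∀ {X u v es vs} → Trail (Usable X) u v es vs → Walk G X u v es vs
  trail⇒walk ε = here
  trail⇒walk ((e∉X , joins) ◅ W) = step e∉X joins (trail⇒walk W)

  connected-refl : ∀ {X} a → SameComponent G X a a
  connected-refl a = [] , _ , here

  connected-trans : ∀ {X a b c} → SameComponent G X a b → SameComponent G X b c → SameComponent G X a c
  connected-trans (_ , _ , here) b~c = b~c
  connected-trans (_ , _ , step e∉X joins W) b~c with connected-trans (_ , _ , W) b~c
  ... | es , vs , W′ = _ , _ , step e∉X joins W′

  connected-sym : ∀ {X a b} → SameComponent G X a b → SameComponent G X b a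
  connected-sym (_ , _ , here) = connected-refl _
  connected-sym (_ , _ , step e∉X joins W) =
    connected-trans (connected-sym (_ , _ , W)) (_ , _ , step e∉X (Joins-sym joins) here)

  connected-antimono : ∀ {X X′ a b} → X ⊆ X′ → SameComponent G X′ a b → SameComponent G X a b
  connected-antimono X⊆X′ (_ , _ , here) = connected-refl _
  connected-antimono X⊆X′ (_ , _ , step e∉X′ joins W) with connected-antimono X⊆X′ (_ , _ , W)
  ... | es , vs , W′ = _ , _ , step (e∉X′ ∘ X⊆X′) joins W′

  closed⇒disconnected : ∀ {X S a b} → Closed (Usable X) S → a ∈ S → b ∉ S → ¬ SameComponent G X a b
  closed⇒disconnected closed a∈S b∉S (_ , _ , here) = b∉S a∈S
  closed⇒disconnected closed a∈S b∉S (_ , _ , step e∉X joins W) =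
    closed⇒disconnected closed (closed a∈S (e∉X , joins)) b∉S (_ , _ , W)

  connected? : ∀ X a b → Dec (SameComponent G X a b)
  connected? X a b with trail-or-closed (λ e u w → ¬? (e ∈? X) ×-dec joins? e u w) a b
  ... | inj₁ (es , vs , W) = yes (es , vs , trail⇒walk W)
  ... | inj₂ (S , a∈S , b∉S , closed) = no (closed⇒disconnected closed a∈S b∉S)

-- How a unit flow uses an edge e: not at all, or one unit along or against the orientation ends G e.
data Use : Set where
  unused forward backward : Use

unused? : (d : Use) → Dec (d ≡ unused)
unused? unused = yes refl
unused? forward = no λ ()
unused? backward = no λ ()

module UnitFlows (G : Multigraph) (X : EdgeSet G) where

  open Trails G
  open Connectivity G
  open IntegerSums
  open import Data.Integer using (+_; _+_; _-_; _*_)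

  private
    V = Vertex G
    E = Fin (m G)

  Flow : Set
  Flow = E → Use

  data Carry : Use → V × V → V → V → Set where
    along   : ∀ {a b} → Carry forward (a , b) a b
    against : ∀ {a b} → Carry backward (a , b) b a

  Carries : Flow → StepRel
  Carries f e = Carry (f e) (ends G e)

  data Residual (f : Flow) : StepRel where
    spare  : ∀ {e u w} → f e ≡ unused → Usable X e u w → Residual f e u w
    cancel : ∀ {e u w} → Carries f e w u → Residual f e u w

  Avoids : Flow → Set
  Avoids f = ∀ e → e ∈ X → f e ≡ unused

  outflow : Use → V × V → V → ℤ
  outflow unused _ v = 0ℤ
  outflow forward (a , b) v = δ a v - δ b v
  outflow backward (a , b) v = δ b v - δ a v

  div : Flow → V → ℤ
  div f v = ∑[ e < m G ] outflow (f e) (ends G e) v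

  _[_]≔_ : Flow → E → Use → Flow
  f [ e ]≔ d = updateAt f e λ _ → d

  outflow-Carry : ∀ {d p a b} → Carry d p a b → ∀ v → outflow d p v ≡ δ a v - δ b v
  outflow-Carry along v = refl
  outflow-Carry against v = refl

  Carry⇒used : ∀ {d p a b} → Carry d p a b → d ≢ unused
  Carry⇒used along ()
  Carry⇒used against ()

  Carry⇒ends : ∀ {d p a b} → Carry d p a b → p ≡ (a , b) ⊎ p ≡ (b , a)
  Carry⇒ends along = inj₁ refl
  Carry⇒ends against = inj₂ refl

  Carries⇒Joins : ∀ {f e a b} → Carries f e a b → Joins G e a b
  Carries⇒Joins = Carry⇒ends

  carry? : ∀ d (p : V × V) a b → Dec (Carry d p a b)
  carry? unused p a b = no λ ()
  carry? forward (x , y) a b with x FinP.≟ a | y FinP.≟ b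
  ... | yes refl | yes refl = yes along
  ... | no x≢a | _ = no λ { along → x≢a refl }
  ... | _ | no y≢b = no λ { along → y≢b refl }
  carry? backward (x , y) a b with y FinP.≟ a | x FinP.≟ b
  ... | yes refl | yes refl = yes against
  ... | no y≢a | _ = no λ { against → y≢a refl }
  ... | _ | no x≢b = no λ { against → x≢b refl }

  residual? : ∀ f e u w → Dec (Residual f e u w)
  residual? f e u w with unused? (f e) ×-dec (¬? (e ∈? X) ×-dec joins? e u w) | carry? (f e) (ends G e) w u
  ... | yes (fe≡unused , usable) | _ = yes (spare fe≡unused usable)
  ... | no _ | yes c = yes (cancel c)
  ... | no ¬spare | no ¬cancel = no λ { (spare fe≡unused usable) → ¬spare (fe≡unused , usable)
                                     ; (cancel c) → ¬cancel c }

  Residual⇒Joins : ∀ {f e u w} → Residual f e u w → Joins G e u w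
  Residual⇒Joins (spare _ (_ , joins)) = joins
  Residual⇒Joins {f} (cancel c) = Joins-sym (Carries⇒Joins {f} c)

  Residual-cong : ∀ {f g e u w} → f e ≡ g e → Residual f e u w → Residual g e u w
  Residual-cong fe≡ge (spare fe≡unused usable) = spare (trans (sym fe≡ge) fe≡unused) usable
  Residual-cong fe≡ge (cancel c) = cancel (subst (λ d → Carry d _ _ _) fe≡ge c)

  div-update : ∀ f e d v → div (f [ e ]≔ d) v ≡ div f v - outflow (f e) (ends G e) v + outflow d (ends G e) v
  div-update f e d v =
    trans (∑-update (λ e′ → outflow (f e′) (ends G e′) v) (λ e′ → outflow ((f [ e ]≔ d) e′) (ends G e′) v) e
                    (λ e′ e′≢e → cong (λ d′ → outflow d′ (ends G e′) v) (updateAt-minimal e′ e f e′≢e)))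
          (cong (λ d′ → div f v - outflow (f e) (ends G e) v + outflow d′ (ends G e) v) (updateAt-updates e f))

  HasValue : V → V → Flow → ℕ → Set
  HasValue s t f j = ∀ v → div f v ≡ + j * (δ s v - δ t v)

  Carries⇒∉X : ∀ {f e a b} → Avoids f → Carries f e a b → e ∉ X
  Carries⇒∉X {f} {e} avoids c e∈X = Carry⇒used c (avoids e e∈X)

  unused-or-Carry : ∀ d {p a b} → p ≡ (a , b) ⊎ p ≡ (b , a) → d ≡ unused ⊎ Carry d p a b ⊎ Carry d p b a
  unused-or-Carry unused _ = inj₁ refl
  unused-or-Carry forward (inj₁ refl) = inj₂ (inj₁ along)
  unused-or-Carry forward (inj₂ refl) = inj₂ (inj₂ along)
  unused-or-Carry backward (inj₁ refl) = inj₂ (inj₂ against)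
  unused-or-Carry backward (inj₂ refl) = inj₂ (inj₁ against)

module Augmentation (G : Multigraph) (X : EdgeSet G) where

  open import Data.Integer using (+_; _+_; _-_; _*_)
  open IntegerSums
  open Trails G
  open UnitFlows G X

  pushed : ∀ {f e u w} → Residual f e u w → Use
  pushed (spare _ (_ , inj₁ _)) = forward
  pushed (spare _ (_ , inj₂ _)) = backward
  pushed (cancel _) = unused

  outflow-pushed : ∀ {f e u w} (r : Residual f e u w) v →
                   outflow (pushed r) (ends G e) v ≡ outflow (f e) (ends G e) v + δ u v - δ w v
  outflow-pushed {u = u} {w} (spare idle (_ , inj₁ ends≡)) v rewrite idle | ends≡ =
    cong (_- δ w v) (sym (ℤP.+-identityˡ (δ u v)))
  outflow-pushed {u = u} {w} (spare idle (_ , inj₂ ends≡)) v rewrite idle | ends≡ =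
    cong (_- δ w v) (sym (ℤP.+-identityˡ (δ u v)))
  outflow-pushed {f} {e} {u} {w} (cancel c) v = begin
    0ℤ                                              ≡⟨ cancels (δ w v) (δ u v) ⟩
    δ w v - δ u v + δ u v - δ w v                   ≡⟨ cong (λ o → o + δ u v - δ w v) (outflow-Carry c v) ⟨
    outflow (f e) (ends G e) v + δ u v - δ w v      ∎
    where
    open ≡-Reasoning
    cancels : ∀ x y → 0ℤ ≡ x - y + y - x
    cancels = solve-∀

  div-pushed : ∀ {f e u w} (r : Residual f e u w) v → div (f [ e ]≔ pushed r) v ≡ div f v + δ u v - δ w v
  div-pushed {f} {e} {u} {w} r v = begin
    div (f [ e ]≔ pushed r) v                         ≡⟨ div-update f e (pushed r) v ⟩
    div f v - o + outflow (pushed r) (ends G e) v     ≡⟨ cong (λ o′ → div f v - o + o′) (outflow-pushed r v) ⟩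
    div f v - o + (o + δ u v - δ w v)                 ≡⟨ telescope (div f v) o (δ u v) (δ w v) ⟩
    div f v + δ u v - δ w v                           ∎
    where
    open ≡-Reasoning
    o = outflow (f e) (ends G e) v
    telescope : ∀ d o x y → d - o + (o + x - y) ≡ d + x - y
    telescope = solve-∀

  pushed-avoids : ∀ {f e u w} (r : Residual f e u w) → Avoids f → Avoids (f [ e ]≔ pushed r)
  pushed-avoids {f} {e} r avoids e′ e′∈X with e′ FinP.≟ e
  ... | no e′≢e = trans (updateAt-minimal e′ e f e′≢e) (avoids e′ e′∈X)
  ... | yes refl = trans (updateAt-updates e f) (outside-X r)
    where
    outside-X : ∀ {u w} (r : Residual f e u w) → pushed r ≡ unused
    outside-X (spare _ (e∉X , _)) = ⊥-elim (e∉X e′∈X)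
    outside-X (cancel _) = refl

  augment : ∀ {u v es vs} (f : Flow) → Avoids f → Trail (Residual f) u v es vs → Unique es →
            ∃ λ g → Avoids g × (∀ x → div g x ≡ div f x + δ u x - δ v x)
  augment {u} f avoids ε _ = f , avoids , λ x → sym (+-sub-cancel (div f x) (δ u x))
  augment {u} {v} f avoids (_◅_ {w = w} {e = e} r W) (e∉es ∷ uniq) =
    let (g , avoids-g , div-g) = augment f′ (pushed-avoids r avoids) (Trail-map transport W) uniq
    in g , avoids-g , λ x → begin
      div g x                                  ≡⟨ div-g x ⟩
      div f′ x + δ w x - δ v x                 ≡⟨ cong (λ d → d + δ w x - δ v x) (div-pushed r x) ⟩
      div f x + δ u x - δ w x + δ w x - δ v x  ≡⟨ telescope (div f x) (δ u x) (δ w x) (δ v x) ⟩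
      div f x + δ u x - δ v x                  ∎
    where
    open ≡-Reasoning
    f′ = f [ e ]≔ pushed r
    transport : ∀ {e′ a b} → e′ ∈ₗ _ → Residual f e′ a b → Residual f′ e′ a b
    transport e′∈ = Residual-cong (sym (updateAt-minimal _ e f (All.lookup e∉es e′∈ ∘ sym)))
    telescope : ∀ d x y z → d + x - y + y - z ≡ d + x - z
    telescope = solve-∀

  augment-value : ∀ {s t j} f → Avoids f → HasValue s t f j → SimpleTrail (Residual f) s t →
                  ∃ λ g → Avoids g × HasValue s t g (suc j)
  augment-value {s} {t} {j} f avoids value (simpleTrail _ _ W simple) =
    let (g , avoids-g , div-g) = augment f avoids W (unique-edges (Residual⇒Joins {f}) W simple)
    in g , avoids-g , λ x → begin
      div g x                                   ≡⟨ div-g x ⟩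
      div f x + δ s x - δ t x                   ≡⟨ cong (λ y → y + δ s x - δ t x) (value x) ⟩
      + j * (δ s x - δ t x) + δ s x - δ t x     ≡⟨ one-more (+ j) (δ s x) (δ t x) ⟩
      + suc j * (δ s x - δ t x)                 ∎
    where
    open ≡-Reasoning
    one-more : ∀ i a b → i * (a - b) + a - b ≡ (1ℤ + i) * (a - b)
    one-more = solve-∀

module FlowDecomposition (G : Multigraph) (X : EdgeSet G) where

  open import Data.Integer using (+_; _+_; _-_; _*_)
  open IntegerSums
  open Trails G
  open Connectivity G
  open UnitFlows G X

  private
    V = Vertex G
    E = Fin (m G)

  _⊑_ : Flow → Flow → Set
  g ⊑ f = ∀ e → g e ≡ unused ⊎ g e ≡ f e

  used : Use → Bool
  used unused = false
  used forward = true
  used backward = true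

  support : Flow → Subset (m G)
  support f = tabulate (used ∘ f)

  ∈-support⁺ : ∀ {f e} → f e ≢ unused → e ∈ support f
  ∈-support⁺ {f} {e} fe≢unused = ∈-tabulate⁺ (used ∘ f) (used-true (f e) fe≢unused)
    where
    used-true : ∀ d → d ≢ unused → used d ≡ true
    used-true unused d≢unused = ⊥-elim (d≢unused refl)
    used-true forward _ = refl
    used-true backward _ = refl

  ∈-support⁻ : ∀ {f e} → e ∈ support f → f e ≢ unused
  ∈-support⁻ {f} {e} e∈ fe≡unused with () ← trans (sym (∈-tabulate⁻ (used ∘ f) e∈)) (cong used fe≡unused)

  support-release : ∀ f e → f e ≢ unused → support (f [ e ]≔ unused) ⊂ support f
  support-release f e fe≢unused = shrinks , e , ∈-support⁺ fe≢unused , released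
    where
    shrinks : support (f [ e ]≔ unused) ⊆ support f
    shrinks {e′} e′∈ with e′ FinP.≟ e
    ... | yes refl = ⊥-elim (∈-support⁻ e′∈ (updateAt-updates e f))
    ... | no e′≢e = ∈-support⁺ (∈-support⁻ e′∈ ∘ trans (updateAt-minimal e′ e f e′≢e))
    released : e ∉ support (f [ e ]≔ unused)
    released e∈ = ∈-support⁻ e∈ (updateAt-updates e f)

  release-idle : ∀ f e {e′} → f e′ ≡ unused → (f [ e ]≔ unused) e′ ≡ unused
  release-idle f e {e′} fe′≡unused with e′ FinP.≟ e
  ... | yes refl = updateAt-updates e f
  ... | no e′≢e = trans (updateAt-minimal e′ e f e′≢e) fe′≡unused

  ⊑-Carries : ∀ {g f e a b} → g ⊑ f → Carries g e a b → Carries f e a b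
  ⊑-Carries {g} {f} {e} g⊑f c with g⊑f e
  ... | inj₁ ge≡unused = ⊥-elim (Carry⇒used c ge≡unused)
  ... | inj₂ ge≡fe = subst (λ d → Carry d _ _ _) ge≡fe c

  ⊑-used : ∀ {g f e} → g ⊑ f → g e ≢ unused → f e ≢ unused
  ⊑-used {g} {f} {e} g⊑f ge≢unused with g⊑f e
  ... | inj₁ ge≡unused = ⊥-elim (ge≢unused ge≡unused)
  ... | inj₂ ge≡fe = ge≢unused ∘ trans ge≡fe

  ⊑-avoids : ∀ {g f} → g ⊑ f → Avoids f → Avoids g
  ⊑-avoids {g} g⊑f avoids e e∈X with g⊑f e
  ... | inj₁ ge≡unused = ge≡unused
  ... | inj₂ ge≡fe = trans ge≡fe (avoids e e∈X)

  ⊑-release : ∀ {g f} e → g ⊑ f → (g [ e ]≔ unused) ⊑ f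
  ⊑-release {g} e g⊑f e′ with e′ FinP.≟ e
  ... | yes refl = inj₁ (updateAt-updates e g)
  ... | no e′≢e = subst (λ d → d ≡ unused ⊎ d ≡ _) (sym (updateAt-minimal e′ e g e′≢e)) (g⊑f e′)

  incoming : ∀ d (p : V × V) v → outflow d p v ℤ.< 0ℤ → ∃ λ w → Carry d p w v
  incoming unused p v negative = ⊥-elim (ℤP.<-irrefl refl negative)
  incoming forward (a , b) v negative with b FinP.≟ v
  ... | yes refl = a , along
  ... | no _ = ⊥-elim (ℤP.<⇒≱ negative (subst (0ℤ ℤ.≤_) (sym (ℤP.+-identityʳ (δ a v))) (δ-nonneg a v)))
  incoming backward (a , b) v negative with a FinP.≟ v
  ... | yes refl = b , against
  ... | no _ = ⊥-elim (ℤP.<⇒≱ negative (subst (0ℤ ℤ.≤_) (sym (ℤP.+-identityʳ (δ b v))) (δ-nonneg b v)))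

  inflow : ∀ f v → div f v ℤ.< 0ℤ → ∃₂ λ e w → Carries f e w v
  inflow f v negative =
    let (e , negative-e) = ∑-negative (λ e → outflow (f e) (ends G e) v) negative
    in e , incoming (f e) (ends G e) v negative-e

  -- Edges of the path from v back to t are removed from rest; edges of cycles cut off on the way
  -- stay removed, which is harmless since only the divergence of rest is tracked.
  record Peeling (t : V) (f : Flow) (v : V) : Set where
    field
      rest     : Flow
      rest⊑f   : rest ⊑ f
      div-rest : ∀ x → div rest x ≡ div f x + δ t x - δ v x
      path     : SimpleTrail (Carries f) v t
      released : ∀ {e} → e ∈ₗ SimpleTrail.edges path → rest e ≡ unused

  peeling-start : ∀ t f → Peeling t f t
  peeling-start t f = record
    { rest = f ; rest⊑f = λ _ → inj₂ refl ; div-rest = λ x → sym (+-sub-cancel (div f x) (δ t x))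
    ; path = simpleTrail [] (t ∷ []) ε ([] ∷ []) ; released = λ () }

  peeling-step : ∀ {t f v e w} (p : Peeling t f v) → Carries (Peeling.rest p) e w v → Peeling t f w
  peeling-step {t} {f} {v} {e} {w} p c = record
    { rest = rest′ ; rest⊑f = ⊑-release e rest⊑f ; div-rest = div-rest′
    ; path = proj₁ extended ; released = released′ ∘ proj₂ extended }
    where
    open Peeling p
    rest′ = rest [ e ]≔ unused
    div-rest′ : ∀ x → div rest′ x ≡ div f x + δ t x - δ w x
    div-rest′ x = begin
      div rest′ x                                         ≡⟨ div-update rest e unused x ⟩
      div rest x - outflow (rest e) (ends G e) x + 0ℤ     ≡⟨ cong₂ (λ d o → d - o + 0ℤ) (div-rest x) (outflow-Carry c x) ⟩
      div f x + δ t x - δ v x - (δ w x - δ v x) + 0ℤ      ≡⟨ telescope (div f x) (δ t x) (δ v x) (δ w x) ⟩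
      div f x + δ t x - δ w x                             ∎
      where
      open ≡-Reasoning
      telescope : ∀ d y z u → d + y - z - (u - z) + 0ℤ ≡ d + y - u
      telescope = solve-∀
    extended = ◅-simple (⊑-Carries rest⊑f c) path
    released′ : ∀ {e′} → e′ ∈ₗ e ∷ SimpleTrail.edges path → rest′ e′ ≡ unused
    released′ (here refl) = updateAt-updates e rest
    released′ (there e′∈) = release-idle rest e (released e′∈)

  deficit-off-source : ∀ {s t f j v} → HasValue s t f (suc j) → s ≢ v → div f v + δ t v - δ v v ℤ.< 0ℤ
  deficit-off-source {s} {t} {f} {j} {v} value s≢v rewrite value v | δ-≢ s≢v | δ-refl v with t FinP.≟ v
  ... | yes refl = subst (ℤ._< 0ℤ) (sym (at-sink (+ suc j))) ℤ.-<+
    where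
    at-sink : ∀ x → x * (0ℤ - 1ℤ) + 1ℤ - 1ℤ ≡ ℤ.- x
    at-sink = solve-∀
  ... | no _ = subst (ℤ._< 0ℤ) (sym (off-sink (+ suc j))) ℤ.-<+
    where
    off-sink : ∀ x → x * (0ℤ - 0ℤ) + 0ℤ - 1ℤ ≡ ℤ.- 1ℤ
    off-sink = solve-∀

  peel : ∀ {s t j} f → HasValue s t f (suc j) → Peeling t f s
  peel {s} {t} {j} f value = go _ (peeling-start t f) ℕP.≤-refl
    where
    go : ∀ fuel {v} (p : Peeling t f v) → ∣ support (Peeling.rest p) ∣ < fuel → Peeling t f s
    go fuel {v} p bound with v FinP.≟ s
    ... | yes refl = p
    ... | no v≢s with inflow rest v (subst (ℤ._< 0ℤ) (sym (div-rest v)) (deficit-off-source {s} {t} {f} {j} value (v≢s ∘ sym)))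
      where open Peeling p
    go (suc fuel) p bound | no _ | e , w , c =
      go fuel (peeling-step p c)
         (ℕP.<-≤-trans (SubsetP.p⊂q⇒∣p∣<∣q∣ (support-release rest e (Carry⇒used c))) (ℕP.≤-pred bound))
      where open Peeling p

  PathsIn : Flow → ℕ → V → V → Set
  PathsIn f j s t = Σ (EdgeDisjointPaths G X j s t) λ paths → ∀ i {e} → e ∈ₗ proj₁ paths i → f e ≢ unused

  PathsIn-cons : ∀ {f rest j s t es} → IsPath G X s t es → (∀ {e} → e ∈ₗ es → f e ≢ unused) →
                 (∀ {e} → e ∈ₗ es → rest e ≡ unused) → rest ⊑ f → PathsIn rest j s t → PathsIn f (suc j) s t
  PathsIn-cons {f} {rest} {j} {s} {t} {es} path path-used released rest⊑f ((Q , Q-paths , Q-disjoint) , Q-uses) =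
    (P , paths , disjoint) , uses
    where
    P : Fin (suc j) → List E
    P zero = es
    P (suc i) = Q i
    paths : ∀ i → IsPath G X s t (P i)
    paths zero = path
    paths (suc i) = Q-paths i
    disjoint : ∀ i i′ e → e ∈ₗ P i → e ∈ₗ P i′ → i ≡ i′
    disjoint zero zero _ _ _ = refl
    disjoint zero (suc i′) e e∈ e∈′ = ⊥-elim (Q-uses i′ e∈′ (released e∈))
    disjoint (suc i) zero e e∈ e∈′ = ⊥-elim (Q-uses i e∈ (released e∈′))
    disjoint (suc i) (suc i′) e e∈ e∈′ = cong suc (Q-disjoint i i′ e e∈ e∈′)
    uses : ∀ i {e} → e ∈ₗ P i → f e ≢ unused
    uses zero = path-used
    uses (suc i) e∈ = ⊑-used rest⊑f (Q-uses i e∈)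

  decompose : ∀ {s t} j f → Avoids f → HasValue s t f j → PathsIn f j s t
  decompose zero f avoids value = ((λ ()) , (λ ()) , λ ()) , λ ()
  decompose {s} {t} (suc j) f avoids value =
    PathsIn-cons (vertices , trail⇒walk (Trail-map (λ _ c → Carries⇒∉X avoids c , Carries⇒Joins {f} c) trail) , simple)
                 (edges-satisfy Carry⇒used trail) released rest⊑f
                 (decompose j rest (⊑-avoids rest⊑f avoids) rest-value)
    where
    open Peeling (peel {s} {t} {j} f value)
    open SimpleTrail path
    rest-value : HasValue s t rest j
    rest-value x = begin
      div rest x                                    ≡⟨ div-rest x ⟩
      div f x + δ t x - δ s x                       ≡⟨ cong (λ d → d + δ t x - δ s x) (value x) ⟩
      + suc j * (δ s x - δ t x) + δ t x - δ s x     ≡⟨ one-less (+ j) (δ s x) (δ t x) ⟩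
      + j * (δ s x - δ t x)                         ∎
      where
      open ≡-Reasoning
      one-less : ∀ k a b → (1ℤ + k) * (a - b) + b - a ≡ k * (a - b)
      one-less = solve-∀

module FlowCut (G : Multigraph) (X : EdgeSet G) {f : UnitFlows.Flow G X} (S : Subset (n G))
               (closed : Trails.Closed G (UnitFlows.Residual G X f) S) where

  open import Data.Integer using (+_; _+_; _-_; _*_)
  open IntegerSums
  open Trails G
  open Connectivity G
  open UnitFlows G X

  private
    V = Vertex G
    E = Fin (m G)

  crosses : Use → V × V → Bool
  crosses unused _ = false
  crosses forward (a , b) = lookup S a ∧ not (lookup S b)
  crosses backward (a , b) = lookup S b ∧ not (lookup S a)

  C : EdgeSet G
  C = tabulate λ e → crosses (f e) (ends G e)

  crossing : ∀ {d p a b} → Carry d p a b → lookup S a ≡ true → lookup S b ≡ false → crosses d p ≡ true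
  crossing along Sa Sb rewrite Sa | Sb = refl
  crossing against Sa Sb rewrite Sa | Sb = refl

  lookup-closed : ∀ {d p} → (∀ {a b} → Carry d p a b → b ∈ S → a ∈ S) →
                  ∀ {a b} → Carry d p a b → lookup S b ≡ true → lookup S a ≡ true
  lookup-closed no-inflow {a} {b} c Sb = []=⇒lookup (no-inflow c (lookup⇒[]= b S Sb))

  flux : ∀ d p → (∀ {a b} → Carry d p a b → b ∈ S → a ∈ S) →
         sum (λ v → χ S v * outflow d p v) ≡ ⟦ crosses d p ⟧
  flux unused p _ = trans (sum-cong-≗ (λ v → ℤP.*-zeroʳ (χ S v))) (sum-replicate-zero (n G))
  flux forward (a , b) no-inflow =
    trans (∑-*-δ-δ (χ S) a b) (⟦⟧-monus (lookup S a) (lookup S b) (lookup-closed no-inflow along))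
  flux backward (a , b) no-inflow =
    trans (∑-*-δ-δ (χ S) b a) (⟦⟧-monus (lookup S b) (lookup S a) (lookup-closed no-inflow against))

  χ-C : ∀ e → χ C e ≡ ⟦ crosses (f e) (ends G e) ⟧
  χ-C e = cong ⟦_⟧ (lookup∘tabulate (λ e′ → crosses (f e′) (ends G e′)) e)

  χ-member : ∀ {v} → v ∈ S → χ S v ≡ 1ℤ
  χ-member v∈S = cong ⟦_⟧ ([]=⇒lookup v∈S)

  χ-nonmember : ∀ {v} → v ∉ S → χ S v ≡ 0ℤ
  χ-nonmember {v} v∉S with lookup S v in Sv
  ... | true = ⊥-elim (v∉S (lookup⇒[]= v S Sv))
  ... | false = refl

  -- No flow enters S (it would give a residual step out of S), so summing the divergence over S
  -- counts the flow edges leaving S, which are exactly the edges of C.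
  cut-size : ∀ {s t j} → s ∈ S → t ∉ S → HasValue s t f j → ∣ C ∣ ≡ j
  cut-size {s} {t} {j} s∈S t∉S value = ℤP.+-injective (begin
    + ∣ C ∣                                ≡⟨ ∑-χ C ⟨
    sum (χ C)                              ≡⟨ sum-cong-≗ edge-flux ⟨
    sum (λ e → sum (λ v → χ S v * o e v))  ≡⟨ ∑-comm (λ e v → χ S v * o e v) ⟩
    sum (λ v → sum (λ e → χ S v * o e v))  ≡⟨ sum-cong-≗ (λ v → *-distribˡ-sum (χ S v) (λ e → o e v)) ⟨
    sum (λ v → χ S v * div f v)            ≡⟨ sum-cong-≗ (λ v → cong (χ S v *_) (value v)) ⟩
    sum (λ v → χ S v * (+ j * Δ v))        ≡⟨ sum-cong-≗ (λ v → *-comm-middle (χ S v) (+ j) (Δ v)) ⟩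
    sum (λ v → + j * (χ S v * Δ v))        ≡⟨ *-distribˡ-sum (+ j) (λ v → χ S v * Δ v) ⟨
    + j * sum (λ v → χ S v * Δ v)          ≡⟨ cong (+ j *_) (∑-*-δ-δ (χ S) s t) ⟩
    + j * (χ S s - χ S t)                  ≡⟨ cong₂ (λ x y → + j * (x - y)) (χ-member s∈S) (χ-nonmember t∉S) ⟩
    + j * 1ℤ                               ≡⟨ ℤP.*-identityʳ (+ j) ⟩
    + j                                    ∎)
    where
    open ≡-Reasoning
    o : E → V → ℤ
    o e v = outflow (f e) (ends G e) v
    Δ : V → ℤ
    Δ v = δ s v - δ t v
    *-comm-middle : ∀ x y z → x * (y * z) ≡ y * (x * z)
    *-comm-middle = solve-∀
    edge-flux : ∀ e → sum (λ v → χ S v * o e v) ≡ χ C e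
    edge-flux e = trans (flux (f e) (ends G e) λ c b∈S → closed b∈S (cancel c)) (sym (χ-C e))

  outside-cut-closed : Closed (Usable (X ∪ C)) S
  outside-cut-closed {e} {a} {b} a∈S (e∉X∪C , joins) with unused-or-Carry (f e) joins
  ... | inj₁ idle = closed a∈S (spare idle (e∉X∪C ∘ SubsetP.x∈p∪q⁺ ∘ inj₁ , joins))
  ... | inj₂ (inj₂ c) = closed a∈S (cancel c)
  ... | inj₂ (inj₁ c) with lookup S b in Sb
  ...   | true = lookup⇒[]= b S Sb
  ...   | false = ⊥-elim (e∉X∪C (SubsetP.x∈p∪q⁺ (inj₂ (∈-tabulate⁺ _ (crossing c ([]=⇒lookup a∈S) Sb)))))

module Menger (G : Multigraph) (X : EdgeSet G) where

  open import Data.Integer using (_-_)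
  open IntegerSums
  open Trails G
  open Connectivity G
  open UnitFlows G X
  open Augmentation G X
  open FlowDecomposition G X

  menger : ∀ s t k → EdgeDisjointPaths G X k s t ⊎ ∃ λ C → ∣ C ∣ < k × ¬ SameComponent G (X ∪ C) s t
  menger s t k = raise 0 k refl (λ _ → unused) (λ _ _ → refl) no-flow
    where
    no-flow : HasValue s t (λ _ → unused) 0
    no-flow x = trans (sum-replicate-zero (m G)) (sym (ℤP.*-zeroˡ (δ s x - δ t x)))

    raise : ∀ j d → j ℕ.+ d ≡ k → ∀ f → Avoids f → HasValue s t f j →
            EdgeDisjointPaths G X k s t ⊎ ∃ λ C → ∣ C ∣ < k × ¬ SameComponent G (X ∪ C) s t
    raise j zero j+0≡k f avoids value =
      inj₁ (subst (λ i → EdgeDisjointPaths G X i s t) (trans (sym (ℕP.+-identityʳ j)) j+0≡k)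
                  (proj₁ (decompose j f avoids value)))
    raise j (suc d) j+1+d≡k f avoids value with trail-or-closed (residual? f) s t
    ... | inj₁ (_ , _ , W) =
      let (g , avoids-g , value-g) = augment-value {j = j} f avoids value (shortcut W)
      in raise (suc j) d (trans (sym (ℕP.+-suc j d)) j+1+d≡k) g avoids-g value-g
    ... | inj₂ (S , s∈S , t∉S , closed) =
      inj₂ (C , subst (_< k) (sym (cut-size s∈S t∉S value)) (subst (j <_) j+1+d≡k (ℕP.m<m+n j ℕ.z<s))
              , closed⇒disconnected outside-cut-closed s∈S t∉S)
      where open FlowCut G X S closed

module Separation (G : Multigraph) (k : ℕ) (A : Subset (n G)) where

  open import Data.Nat using (_+_; _*_)
  open Connectivity G
  open Menger G using (menger)

  private
    V = Vertex G
    K = k ∸ 1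

  Solution : Set
  Solution = ∃ λ X → ∣ X ∣ ≤ (∣ A ∣ ∸ 1) * K × PerfectlySeparates G k X A

  record Progress (R : Subset (n G)) : Set where
    field
      X         : EdgeSet G
      R⊆A       : R ⊆ A
      separated : ∀ {r r′} → r ∈ R → r′ ∈ R → SameComponent G X r r′ → r ≡ r′
      budget    : ∣ X ∣ + K ≤ ∣ R ∣ * K   -- i.e. ∣ X ∣ ≤ (∣ R ∣ − 1) K, without truncated subtraction

  Violation : EdgeSet G → V → V → Set
  Violation X a a′ = a ∈ A × a′ ∈ A × SameComponent G X a a′ × ∃ λ C → ∣ C ∣ < k × ¬ SameComponent G (X ∪ C) a a′

  Respected : EdgeSet G → V → V → Set
  Respected X a a′ = a ∈ A → a′ ∈ A → ¬ Sim G X k a a′ → ¬ SameComponent G X a a′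

  respected-or-violated : ∀ X a a′ → Respected X a a′ ⊎ Violation X a a′
  respected-or-violated X a a′ with a ∈? A | a′ ∈? A
  ... | no a∉A | _ = inj₁ λ a∈A → ⊥-elim (a∉A a∈A)
  ... | yes _ | no a′∉A = inj₁ λ _ a′∈A → ⊥-elim (a′∉A a′∈A)
  ... | yes a∈A | yes a′∈A with menger X a a′ k | connected? X a a′
  ...   | inj₁ paths | _ = inj₁ λ _ _ ¬sim → ⊥-elim (¬sim (inj₂ paths))
  ...   | inj₂ _ | no apart = inj₁ λ _ _ _ → apart
  ...   | inj₂ cut | yes together = inj₂ (a∈A , a′∈A , together , cut)

  adjoin : ∀ {R X′ x} → R ⊆ A → x ∈ A → x ∉ R →
           (∀ {r r′} → r ∈ R → r′ ∈ R → SameComponent G X′ r r′ → r ≡ r′) →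
           (∀ {r} → r ∈ R → ¬ SameComponent G X′ x r) →
           ∣ X′ ∣ + K ≤ suc ∣ R ∣ * K →
           ∃ λ R′ → R ⊂ R′ × Progress R′
  adjoin {R} {X′} {x} R⊆A x∈A x∉R separated x-apart budget =
    ⁅ x ⁆ ∪ R , R⊂R′ , record { X = X′ ; R⊆A = R′⊆A ; separated = separated′ ; budget = budget′ }
    where
    R⊂R′ = p⊂⁅x⁆∪p x∉R
    R′⊆A : ⁅ x ⁆ ∪ R ⊆ A
    R′⊆A y∈ with ∈⁅x⁆∪p⁻ y∈
    ... | inj₁ refl = x∈A
    ... | inj₂ y∈R = R⊆A y∈R
    separated′ : ∀ {r r′} → r ∈ ⁅ x ⁆ ∪ R → r′ ∈ ⁅ x ⁆ ∪ R → SameComponent G X′ r r′ → r ≡ r′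
    separated′ r∈ r′∈ r~r′ with ∈⁅x⁆∪p⁻ r∈ | ∈⁅x⁆∪p⁻ r′∈
    ... | inj₁ refl | inj₁ refl = refl
    ... | inj₁ refl | inj₂ r′∈R = ⊥-elim (x-apart r′∈R r~r′)
    ... | inj₂ r∈R | inj₁ refl = ⊥-elim (x-apart r∈R (connected-sym r~r′))
    ... | inj₂ r∈R | inj₂ r′∈R = separated r∈R r′∈R r~r′
    budget′ : ∣ X′ ∣ + K ≤ ∣ ⁅ x ⁆ ∪ R ∣ * K
    budget′ = ℕP.≤-trans budget (ℕP.*-monoˡ-≤ K (SubsetP.p⊂q⇒∣p∣<∣q∣ R⊂R′))

  cut-off : ∀ {R r x C} (p : Progress R) → r ∈ R → x ∈ A → ∣ C ∣ < k →
            SameComponent G (Progress.X p) r x → ¬ SameComponent G (Progress.X p ∪ C) r x →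
            ∃ λ R′ → R ⊂ R′ × Progress R′
  cut-off {R} {r} {x} {C} p r∈R x∈A ∣C∣<k r~x r≁′x =
    adjoin R⊆A x∈A x∉R (λ r∈ r′∈ → separated r∈ r′∈ ∘ connected-antimono X⊆X′) x-apart budget′
    where
    open Progress p
    X′ = X ∪ C
    X⊆X′ : X ⊆ X′
    X⊆X′ = SubsetP.p⊆p∪q C
    x∉R : x ∉ R
    x∉R x∈R = r≁′x (subst (SameComponent G X′ r) (separated r∈R x∈R r~x) (connected-refl r))
    x-apart : ∀ {r′} → r′ ∈ R → ¬ SameComponent G X′ x r′
    x-apart r′∈R x~′r′ = r≁′x (connected-sym (subst (SameComponent G X′ x) (sym r≡r′) x~′r′))
      where
      r≡r′ = separated r∈R r′∈R (connected-trans r~x (connected-antimono X⊆X′ x~′r′))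
    budget′ : ∣ X′ ∣ + K ≤ suc ∣ R ∣ * K
    budget′ = begin
      ∣ X ∪ C ∣ + K      ≤⟨ ℕP.+-monoˡ-≤ K (∣p∪q∣≤∣p∣+∣q∣ X C) ⟩
      ∣ X ∣ + ∣ C ∣ + K  ≤⟨ ℕP.+-monoˡ-≤ K (ℕP.+-monoʳ-≤ ∣ X ∣ (<⇒≤∸1 ∣C∣<k)) ⟩
      ∣ X ∣ + K + K      ≤⟨ ℕP.+-monoˡ-≤ K budget ⟩
      ∣ R ∣ * K + K      ≡⟨ ℕP.+-comm (∣ R ∣ * K) K ⟩
      suc ∣ R ∣ * K      ∎
      where
      open ℕP.≤-Reasoning
      <⇒≤∸1 : ∀ {i j} → i < j → i ≤ j ∸ 1
      <⇒≤∸1 (ℕ.s≤s i≤j) = i≤j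

  resolve : ∀ {R a a′} (p : Progress R) → Violation (Progress.X p) a a′ → ∃ λ R′ → R ⊂ R′ × Progress R′
  resolve {R} {a} {a′} p (a∈A , a′∈A , a~a′ , C , ∣C∣<k , a≁a′) with any? (λ r → (r ∈? R) ×-dec connected? X r a)
    where open Progress p
  ... | no no-rep = adjoin R⊆A a∈A a∉R separated a-apart (ℕP.≤-trans budget (ℕP.m≤n+m (∣ R ∣ * K) K))
    where
    open Progress p
    a∉R : a ∉ R
    a∉R a∈R = no-rep (a , a∈R , connected-refl a)
    a-apart : ∀ {r} → r ∈ R → ¬ SameComponent G X a r
    a-apart {r} r∈R a~r = no-rep (r , r∈R , connected-sym a~r)
  ... | yes (r , r∈R , r~a) with connected? (Progress.X p ∪ C) r a
  ...   | no r≁′a = cut-off p r∈R a∈A ∣C∣<k r~a r≁′a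
  ...   | yes r~′a = cut-off p r∈R a′∈A ∣C∣<k (connected-trans r~a a~a′) (a≁a′ ∘ connected-trans (connected-sym r~′a))

  advance : ∀ {R} → Progress R → Solution ⊎ ∃ λ R′ → R ⊂ R′ × Progress R′
  advance {R} p with ∀⊎∃ (λ a → ∀⊎∃ (λ a′ → respected-or-violated X a a′))
    where open Progress p
  ... | inj₁ respected = inj₁ (X , bound , λ a a′ → respected a a′)
    where
    open Progress p
    bound : ∣ X ∣ ≤ (∣ A ∣ ∸ 1) * K
    bound = begin
      ∣ X ∣              ≤⟨ ℕP.m+n≤o⇒m≤o∸n ∣ X ∣ (ℕP.≤-trans budget (ℕP.*-monoˡ-≤ K (SubsetP.p⊆q⇒∣p∣≤∣q∣ R⊆A))) ⟩
      ∣ A ∣ * K ∸ K      ≡⟨ cong (∣ A ∣ * K ∸_) (ℕP.*-identityˡ K) ⟨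
      ∣ A ∣ * K ∸ 1 * K  ≡⟨ ℕP.*-distribʳ-∸ K ∣ A ∣ 1 ⟨
      (∣ A ∣ ∸ 1) * K    ∎
      where open ℕP.≤-Reasoning
  ... | inj₂ (a , a′ , violation) = inj₂ (resolve p violation)

  start : ∀ {a} → a ∈ A → Progress ⁅ a ⁆
  start {a} a∈A = record
    { X = ⊥
    ; R⊆A = λ r∈ → subst (_∈ A) (sym (SubsetP.x∈⁅y⁆⇒x≡y a r∈)) a∈A
    ; separated = λ r∈ r′∈ _ → trans (SubsetP.x∈⁅y⁆⇒x≡y a r∈) (sym (SubsetP.x∈⁅y⁆⇒x≡y a r′∈))
    ; budget = subst₂ (λ e r → e + K ≤ r * K) (sym (SubsetP.∣⊥∣≡0 (m G))) (sym (SubsetP.∣⁅x⁆∣≡1 a))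
                      (ℕP.≤-reflexive (sym (ℕP.*-identityˡ K)))
    }

open import Data.Nat using (_*_)

lemma11 : (k : ℕ) → 1 ≤ k → (G : Multigraph) → (A : Subset (n G)) →
          ∃[ a ] a ∈ A →
          ∃[ X ] (∣ X ∣ ≤ (∣ A ∣ ∸ 1) * (k ∸ 1) × PerfectlySeparates G k X A)
lemma11 k _ G A (a , a∈A) = ⊂-growth-terminates Progress Progress.R⊆A advance (start a∈A)
  where open Separation G k A
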